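{- Let $G$ be a simple graph with maximum degree $\Delta(G)$ and let $r \geq 2$ be an integer. Then $\chi_r(G) \leq (r - 1)(\Delta(G) + 1) + 2$.
   Context: Graphs are finite and simple. For a vertex $v$, $N(v)$ is its set of neighbors and $\deg(v)=|N(v)|$; $\Delta(G)$ is the maximum vertex degree. For a coloring $\phi$ and a set of vertices $U$, $\phi(U)=\{\phi(u): u\in U\}$. An $r$-hued coloring of $G$ is a proper vertex coloring $\phi$ of $G$ (adjacent vertices receive distinct colors) such that $|\phi(N(v))| \geq \min\{r, \deg(v)\}$ for every vertex $v$. The $r$-hued chromatic number $\chi_r(G)$ is the minimum number of colors in an $r$-hued coloring of $G$. -}

module Defs where

open import Data.Nat using (ℕ; zero; suc; _+_; _*_; _∸_; _⊔_; _⊓_; _≤_)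
open import Data.Bool using (Bool; true; false; _∧_; _∨_; if_then_else_)
open import Data.Fin using (Fin; zero; suc; _≟_)
open import Data.Product using (Σ; _×_)
open import Relation.Nullary.Decidable using (⌊_⌋)
open import Relation.Binary.PropositionalEquality using (_≡_; _≢_)

record Graph (n : ℕ) : Set where
  field
    adj    : Fin n → Fin n → Bool
    sym    : ∀ u v → adj u v ≡ adj v u
    irrefl : ∀ v → adj v v ≡ false
open Graph public

countTrue : ∀ {n} → (Fin n → Bool) → ℕ
countTrue {zero}  p = 0
countTrue {suc n} p = (if p zero then 1 else 0) + countTrue (λ i → p (suc i))

anyFin : ∀ {n} → (Fin n → Bool) → Bool
anyFin {zero}  p = false
anyFin {suc n} p = p zero ∨ anyFin (λ i → p (suc i))

maxFin : ∀ {n} → (Fin n → ℕ) → ℕ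
maxFin {zero}  f = 0
maxFin {suc n} f = f zero ⊔ maxFin (λ i → f (suc i))

deg : ∀ {n} → Graph n → Fin n → ℕ
deg G v = countTrue (adj G v)

maxDegree : ∀ {n} → Graph n → ℕ
maxDegree G = maxFin (deg G)

nbrColors : ∀ {n k} → Graph n → (Fin n → Fin k) → Fin n → ℕ
nbrColors G φ v = countTrue (λ c → anyFin (λ u → adj G v u ∧ ⌊ φ u ≟ c ⌋))

Proper : ∀ {n k} → Graph n → (Fin n → Fin k) → Set
Proper G φ = ∀ u v → adj G u v ≡ true → φ u ≢ φ v

IsRHued : ∀ {n k} → ℕ → Graph n → (Fin n → Fin k) → Set
IsRHued r G φ = Proper G φ × (∀ v → r ⊓ deg G v ≤ nbrColors G φ v)

-- χ_r(G) ≤ k : there is an r-hued coloring using (at most) k colors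
χ-≤ : ∀ {n} → ℕ → Graph n → ℕ → Set
χ-≤ {n} r G k = Σ (Fin n → Fin k) (IsRHued r G)

-- Color greedily in reverse degeneracy order: delete a vertex w of minimum degree in the
-- remaining graph, color the rest, and give w a color avoiding the colors of its a colored
-- neighbors and, for every neighbor v that still sees fewer than r colors, the at most r − 1
-- colors seen by v, so that w shows v a new color.  The invariant is the r-hued condition in
-- which deg v is replaced by the number of colored neighbors of v.  If a ≤ r this excludes at
-- most r + (r − 1)Δ colors.  If a > r, minimality of w gives every colored neighbor of w at
-- least r colored neighbors, so it already sees r colors and only the uncolored neighbors
-- contribute: at most a + (r − 1)(Δ − a) ≤ (r − 1)Δ colors.  Either way one of the
-- (r − 1)(Δ + 1) + 2 colors is free.

module Submission where

open import Defs hiding (sym)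
open import Data.Bool using (Bool; true; false; _∧_; _∨_; if_then_else_)
open import Data.Bool.Properties using (∧-conicalˡ; ∧-conicalʳ; ∨-conicalˡ; ∨-conicalʳ; ∧-distribˡ-∨)
open import Data.Empty using (⊥; ⊥-elim)
open import Data.Fin using (Fin; zero; suc; _≟_; _↑ʳ_)
open import Data.Fin.Properties using (suc-injective)
open import Data.Nat using (ℕ; zero; suc; _+_; _*_; _∸_; _⊓_; _≤_; _<_; z≤n; s≤s; _≤?_; _<?_)
open import Data.Nat.Properties hiding (_≟_; suc-injective)
open import Data.Nat.Tactic.RingSolver using (solve-∀)
open import Data.Product using (Σ; ∃; _×_; _,_)
open import Data.Sum using (_⊎_; inj₁; inj₂)
open import Data.Vec.Functional using (updateAt)
open import Data.Vec.Functional.Properties using (updateAt-updates; updateAt-minimal)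
open import Function using (_∘_)
open import Relation.Binary.PropositionalEquality using (_≡_; _≢_; refl; sym; trans; cong; cong₂; subst)
open import Relation.Nullary using (Dec; yes; no; ¬_)
open import Relation.Nullary.Decidable using (⌊_⌋; isYes≗does; dec-true; dec-false)

private
  variable
    k m n : ℕ

false≢true : false ≢ true
false≢true ()

isYes-true : {A : Set} (a? : Dec A) → A → ⌊ a? ⌋ ≡ true
isYes-true a? a = trans (isYes≗does a?) (dec-true a? a)

isYes-false : {A : Set} (a? : Dec A) → ¬ A → ⌊ a? ⌋ ≡ false
isYes-false a? ¬a = trans (isYes≗does a?) (dec-false a? ¬a)

isYes-sound : {A : Set} (a? : Dec A) → ⌊ a? ⌋ ≡ true → A
isYes-sound (yes a) _ = a

indicator-mono : {a b : Bool} → (a ≡ true → b ≡ true) → (if a then 1 else 0) ≤ (if b then 1 else 0)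
indicator-mono {false}         _   = z≤n
indicator-mono {true} {true}   _   = ≤-refl
indicator-mono {true} {false} a⇒b with () ← a⇒b refl

countTrue-const-false : countTrue {n} (λ _ → false) ≡ 0
countTrue-const-false {zero}  = refl
countTrue-const-false {suc n} = countTrue-const-false {n}

countTrue-mono : {p q : Fin n → Bool} → (∀ i → p i ≡ true → q i ≡ true) →
                 countTrue p ≤ countTrue q
countTrue-mono {zero}  p⇒q = z≤n
countTrue-mono {suc n} p⇒q = +-mono-≤ (indicator-mono (p⇒q zero)) (countTrue-mono (p⇒q ∘ suc))

countTrue-mono-< : {p q : Fin n → Bool} (x : Fin n) → (∀ i → p i ≡ true → q i ≡ true) →
                   p x ≡ false → q x ≡ true → countTrue p < countTrue q
countTrue-mono-< zero p⇒q px qx rewrite px | qx = s≤s (countTrue-mono (p⇒q ∘ suc))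
countTrue-mono-< (suc x) p⇒q px qx =
  +-mono-≤-< (indicator-mono (p⇒q zero)) (countTrue-mono-< x (p⇒q ∘ suc) px qx)

countTrue-∨≤ : (p q : Fin n → Bool) → countTrue (λ i → p i ∨ q i) ≤ countTrue p + countTrue q
countTrue-∨≤ {zero}  p q = z≤n
countTrue-∨≤ {suc n} p q with p zero | q zero
... | true  | false = s≤s (countTrue-∨≤ (p ∘ suc) (q ∘ suc))
... | true  | true  = s≤s (≤-trans (countTrue-∨≤ (p ∘ suc) (q ∘ suc)) (+-monoʳ-≤ _ (n≤1+n _)))
... | false | false = countTrue-∨≤ (p ∘ suc) (q ∘ suc)
... | false | true  = ≤-trans (s≤s (countTrue-∨≤ (p ∘ suc) (q ∘ suc))) (≤-reflexive (sym (+-suc _ _)))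

countTrue-disjoint-∨ : (p q : Fin n → Bool) → (∀ i → p i ≡ true → q i ≡ true → ⊥) →
                       countTrue p + countTrue q ≡ countTrue (λ i → p i ∨ q i)
countTrue-disjoint-∨ {zero}  p q disj = refl
countTrue-disjoint-∨ {suc n} p q disj with p zero in p0 | q zero in q0
... | true  | true  = ⊥-elim (disj zero p0 q0)
... | true  | false = cong suc (countTrue-disjoint-∨ (p ∘ suc) (q ∘ suc) (disj ∘ suc))
... | false | true  = trans (+-suc _ _) (cong suc (countTrue-disjoint-∨ (p ∘ suc) (q ∘ suc) (disj ∘ suc)))
... | false | false = countTrue-disjoint-∨ (p ∘ suc) (q ∘ suc) (disj ∘ suc)

countTrue-≤1 : (p : Fin n → Bool) → (∀ i j → p i ≡ true → p j ≡ true → i ≡ j) → countTrue p ≤ 1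
countTrue-≤1 {zero}  p unique = z≤n
countTrue-≤1 {suc n} p unique with p zero in p0
... | true  = s≤s (≤-trans (countTrue-mono only-zero) (≤-reflexive (countTrue-const-false {n})))
  where
  only-zero : ∀ i → p (suc i) ≡ true → false ≡ true
  only-zero i pi with () ← unique (suc i) zero pi p0
... | false = countTrue-≤1 (p ∘ suc) (λ i j pi pj → suc-injective (unique (suc i) (suc j) pi pj))

countTrue<⇒false : (p : Fin n → Bool) → countTrue p < n → ∃ λ i → p i ≡ false
countTrue<⇒false {suc n} p cnt<n with p zero in p0
... | false = zero , p0
... | true with countTrue<⇒false (p ∘ suc) (≤-pred cnt<n)
...   | i , pi = suc i , pi

anyFin-intro : (p : Fin n → Bool) (i : Fin n) → p i ≡ true → anyFin p ≡ true
anyFin-intro p zero    pi rewrite pi = refl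
anyFin-intro p (suc i) pi with p zero
... | true  = refl
... | false = anyFin-intro (p ∘ suc) i pi

anyFin-elim : (p : Fin n → Bool) → anyFin p ≡ true → ∃ λ i → p i ≡ true
anyFin-elim {suc n} p any with p zero in p0
... | true  = zero , p0
... | false with anyFin-elim (p ∘ suc) any
...   | i , pi = suc i , pi

countTrue-anyFin≤ : (S : Fin m → Bool) (P : Fin m → Fin n → Bool) (b : ℕ) →
                   (∀ v → S v ≡ true → countTrue (P v) ≤ b) →
                   countTrue (λ c → anyFin (λ v → S v ∧ P v c)) ≤ countTrue S * b
countTrue-anyFin≤ {zero} {n} S P b bound = ≤-reflexive (countTrue-const-false {n})
countTrue-anyFin≤ {suc m} S P b bound with S zero in s0
... | true  = ≤-trans (countTrue-∨≤ (P zero) _)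
                      (+-mono-≤ (bound zero s0) (countTrue-anyFin≤ (S ∘ suc) (P ∘ suc) b (bound ∘ suc)))
... | false = countTrue-anyFin≤ (S ∘ suc) (P ∘ suc) b (bound ∘ suc)

anyFin-false : (p : Fin n → Bool) (i : Fin n) → anyFin p ≡ false → p i ≡ false
anyFin-false p zero    none = ∨-conicalˡ _ _ none
anyFin-false p (suc i) none = anyFin-false (p ∘ suc) i (∨-conicalʳ _ _ none)

countTrue-mono-except : {p q : Fin n → Bool} (w : Fin n) → (∀ i → i ≢ w → p i ≡ true → q i ≡ true) →
                        countTrue p ≤ suc (countTrue q)
countTrue-mono-except {p = p} {q} w p⇒q =
  ≤-trans (countTrue-mono p⇒w∨q)
          (≤-trans (countTrue-∨≤ (λ i → ⌊ w ≟ i ⌋) q) (+-monoˡ-≤ _ (countTrue-≤1 _ same)))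
  where
  p⇒w∨q : ∀ i → p i ≡ true → ⌊ w ≟ i ⌋ ∨ q i ≡ true
  p⇒w∨q i pi with w ≟ i
  ... | yes _   = refl
  ... | no  w≢i = p⇒q i (w≢i ∘ sym) pi
  same : ∀ i j → ⌊ w ≟ i ⌋ ≡ true → ⌊ w ≟ j ⌋ ≡ true → i ≡ j
  same i j w≡i w≡j = trans (sym (isYes-sound (w ≟ i) w≡i)) (isYes-sound (w ≟ j) w≡j)

maxFin-≥ : (f : Fin n → ℕ) (i : Fin n) → f i ≤ maxFin f
maxFin-≥ f zero    = m≤m⊔n (f zero) _
maxFin-≥ f (suc i) = ≤-trans (maxFin-≥ (f ∘ suc) i) (m≤n⊔m (f zero) _)

m⊓n≤o<m⇒n≤o : ∀ {m n o} → m ⊓ n ≤ o → o < m → n ≤ o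
m⊓n≤o<m⇒n≤o {m} {n} m⊓n≤o o<m with m ≤? n
... | yes m≤n = ⊥-elim (<⇒≱ o<m (≤-trans (≤-reflexive (sym (m≤n⇒m⊓n≡m m≤n))) m⊓n≤o))
... | no  m≰n = ≤-trans (≤-reflexive (sym (m≥n⇒m⊓n≡n (<⇒≤ (≰⇒> m≰n))))) m⊓n≤o

budget-identity : ∀ p Δ → 2 + p + Δ * p ≡ p * (Δ + 1) + 2
budget-identity = solve-∀

color-budget : ∀ r a s Δ → 2 ≤ r → (a ≤ r × s ≤ Δ) ⊎ (a + s ≤ Δ) →
               a + s * (r ∸ 1) < (r ∸ 1) * (Δ + 1) + 2
color-budget (suc zero) a s Δ (s≤s ()) cases
color-budget (suc (suc q)) a s Δ _ cases =
  ≤-trans (s≤s (bound cases)) (≤-reflexive (budget-identity (suc q) Δ))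
  where
  bound : (a ≤ suc (suc q) × s ≤ Δ) ⊎ (a + s ≤ Δ) → a + s * suc q ≤ suc (suc q) + Δ * suc q
  bound (inj₁ (a≤r , s≤Δ)) = +-mono-≤ a≤r (*-monoˡ-≤ (suc q) s≤Δ)
  bound (inj₂ a+s≤Δ)       = begin
    a + s * suc q            ≤⟨ +-monoˡ-≤ _ (m≤m*n a (suc q)) ⟩
    a * suc q + s * suc q    ≡⟨ *-distribʳ-+ (suc q) a s ⟨
    (a + s) * suc q          ≤⟨ *-monoˡ-≤ (suc q) a+s≤Δ ⟩
    Δ * suc q                ≤⟨ m≤n+m _ (suc (suc q)) ⟩
    suc (suc q) + Δ * suc q  ∎
    where open ≤-Reasoning

delete : (Fin n → Bool) → Fin n → Fin n → Bool
delete S w = updateAt S w (λ _ → false)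

delete-self : (S : Fin n → Bool) (w : Fin n) → delete S w w ≡ false
delete-self S w = updateAt-updates w S

delete-other : (S : Fin n → Bool) {u w : Fin n} → u ≢ w → delete S w u ≡ S u
delete-other S {u} {w} u≢w = updateAt-minimal u w S u≢w

delete-⊆ : (S : Fin n → Bool) (w u : Fin n) → delete S w u ≡ true → S u ≡ true
delete-⊆ S w u u∈ with u ≟ w
... | yes refl with () ← trans (sym (delete-self S w)) u∈
... | no  u≢w = trans (sym (delete-other S u≢w)) u∈

countTrue-delete : (S : Fin n → Bool) {w : Fin n} → S w ≡ true → countTrue (delete S w) < countTrue S
countTrue-delete S {w} Sw = countTrue-mono-< w (delete-⊆ S w) (delete-self S w) Sw

nbrsIn : Graph n → (Fin n → Bool) → Fin n → Fin n → Bool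
nbrsIn G S v u = adj G v u ∧ S u

degIn : Graph n → (Fin n → Bool) → Fin n → ℕ
degIn G S v = countTrue (nbrsIn G S v)

colorsOf : (Fin n → Bool) → (Fin n → Fin k) → Fin k → Bool
colorsOf S φ c = anyFin (λ u → S u ∧ ⌊ φ u ≟ c ⌋)

nbrColorsIn : Graph n → (Fin n → Bool) → (Fin n → Fin k) → Fin n → ℕ
nbrColorsIn G S φ v = countTrue (colorsOf (nbrsIn G S v) φ)

colorsOf-∋ : (S : Fin n → Bool) (φ : Fin n → Fin k) {u : Fin n} → S u ≡ true → colorsOf S φ (φ u) ≡ true
colorsOf-∋ S φ {u} Su = anyFin-intro _ u (cong₂ _∧_ Su (isYes-true (φ u ≟ φ u) refl))

colorsOf-mono : (S T : Fin n → Bool) {φ ψ : Fin n → Fin k} →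
                (∀ u → S u ≡ true → T u ≡ true × ψ u ≡ φ u) →
                ∀ c → colorsOf S φ c ≡ true → colorsOf T ψ c ≡ true
colorsOf-mono S T {φ} {ψ} S⇒T c c∈S with anyFin-elim _ c∈S
... | u , Su∧φu≡c with S⇒T u (∧-conicalˡ _ _ Su∧φu≡c) | isYes-sound (φ u ≟ c) (∧-conicalʳ _ _ Su∧φu≡c)
...   | Tu , ψu≡φu | refl = subst (λ c → colorsOf T ψ c ≡ true) ψu≡φu (colorsOf-∋ T ψ Tu)

countTrue-colorsOf≤ : (S : Fin n → Bool) (φ : Fin n → Fin k) → countTrue (colorsOf S φ) ≤ countTrue S
countTrue-colorsOf≤ S φ = ≤-trans (countTrue-anyFin≤ S (λ u c → ⌊ φ u ≟ c ⌋) 1 at-most-one)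
                                  (≤-reflexive (*-identityʳ _))
  where
  at-most-one : ∀ u → S u ≡ true → countTrue (λ c → ⌊ φ u ≟ c ⌋) ≤ 1
  at-most-one u _ = countTrue-≤1 _ λ i j φu≡i φu≡j →
    trans (sym (isYes-sound (φ u ≟ i) φu≡i)) (isYes-sound (φ u ≟ j) φu≡j)

degIn≤deg : (G : Graph n) (S : Fin n → Bool) (v : Fin n) → degIn G S v ≤ deg G v
degIn≤deg G S v = countTrue-mono {p = nbrsIn G S v} λ u e → ∧-conicalˡ _ _ e

degIn-mono : (G : Graph n) {S T : Fin n → Bool} → (∀ u → S u ≡ true → T u ≡ true) →
             ∀ v → degIn G S v ≤ degIn G T v
degIn-mono G S⇒T v = countTrue-mono λ u e → cong₂ _∧_ (∧-conicalˡ _ _ e) (S⇒T u (∧-conicalʳ _ _ e))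

degIn-delete : (G : Graph n) (S : Fin n → Bool) (w v : Fin n) → degIn G S v ≤ suc (degIn G (delete S w) v)
degIn-delete G S w v = countTrue-mono-except w λ u u≢w e → trans (cong (adj G v u ∧_) (delete-other S u≢w)) e

degIn-delete-nonadj : (G : Graph n) (S : Fin n → Bool) {w v : Fin n} → adj G v w ≡ false →
                      degIn G S v ≤ degIn G (delete S w) v
degIn-delete-nonadj G S {w} {v} vw = countTrue-mono kept
  where
  kept : ∀ u → adj G v u ∧ S u ≡ true → adj G v u ∧ delete S w u ≡ true
  kept u e with u ≟ w
  ... | yes refl with () ← trans (sym vw) (∧-conicalˡ _ _ e)
  ... | no  u≢w = trans (cong (adj G v u ∧_) (delete-other S u≢w)) e

record IsRHuedOn (r : ℕ) (G : Graph n) (S : Fin n → Bool) (φ : Fin n → Fin k) : Set where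
  field
    proper-on : ∀ u v → S u ≡ true → S v ≡ true → adj G u v ≡ true → φ u ≢ φ v
    hued-on   : ∀ v → r ⊓ degIn G S v ≤ nbrColorsIn G S φ v
open IsRHuedOn

isRHuedOn-empty : {r : ℕ} {G : Graph n} {S : Fin n → Bool} (φ : Fin n → Fin k) →
                  (∀ u → S u ≡ false) → IsRHuedOn r G S φ
isRHuedOn-empty {n = n} {r = r} {G} {S} φ empty = record
  { proper-on = λ u _ Su → ⊥-elim (false≢true (trans (sym (empty u)) Su))
  ; hued-on   = λ v → ≤-trans (m⊓n≤n r _) (≤-trans (no-neighbors v) z≤n)
  }
  where
  no-neighbors : ∀ v → degIn G S v ≤ 0
  no-neighbors v = ≤-trans (countTrue-mono λ u e → trans (sym (empty u)) (∧-conicalʳ _ _ e))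
                           (≤-reflexive (countTrue-const-false {n}))

isRHuedOn-all⇒isRHued : {r : ℕ} {G : Graph n} {φ : Fin n → Fin k} →
                        IsRHuedOn r G (λ _ → true) φ → IsRHued r G φ
isRHuedOn-all⇒isRHued {n = n} {k = k} {r = r} {G} {φ} hued = (λ u v → proper-on hued u v refl refl) , hued-all
  where
  hued-all : ∀ v → r ⊓ deg G v ≤ nbrColors G φ v
  hued-all v = ≤-trans (⊓-monoʳ-≤ r deg≤) (≤-trans (hued-on hued v) colors≤)
    where
    deg≤ : deg G v ≤ degIn G (λ _ → true) v
    deg≤ = countTrue-mono {n = n} λ u e → cong (_∧ true) e
    colors≤ : nbrColorsIn G (λ _ → true) φ v ≤ nbrColors G φ v
    colors≤ = countTrue-mono {n = k} (colorsOf-mono (λ u → adj G v u ∧ true) (adj G v) λ u e → ∧-conicalˡ _ _ e , refl)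

unsaturated : ℕ → Graph n → (Fin n → Bool) → (Fin n → Fin k) → Fin n → Bool
unsaturated r G S φ v = ⌊ nbrColorsIn G S φ v <? r ⌋

forbidden : ℕ → Graph n → (Fin n → Bool) → (Fin n → Fin k) → Fin n → Fin k → Bool
forbidden r G S φ w c =
  colorsOf (nbrsIn G S w) φ c ∨
  anyFin (λ v → nbrsIn G (unsaturated r G S φ) w v ∧ colorsOf (nbrsIn G S v) φ c)

module Extension {n k r : ℕ} {G : Graph n} {S : Fin n → Bool} {w : Fin n} {φ : Fin n → Fin k} {c : Fin k}
                 (Sw : S w ≡ true) (hued : IsRHuedOn r G (delete S w) φ)
                 (allowed : forbidden r G (delete S w) φ w c ≡ false) where

  private
    C : Fin n → Bool
    C = delete S w

    φ′ : Fin n → Fin k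
    φ′ = updateAt φ w (λ _ → c)

    φ′-self : φ′ w ≡ c
    φ′-self = updateAt-updates w φ

    φ′-other : ∀ {u} → u ≢ w → φ′ u ≡ φ u
    φ′-other u≢w = updateAt-minimal _ w φ u≢w

    C-≢ : ∀ {u} → C u ≡ true → u ≢ w
    C-≢ Cu refl = false≢true (trans (sym (delete-self S w)) Cu)

    S⇒C : ∀ {u} → u ≢ w → S u ≡ true → C u ≡ true
    S⇒C u≢w Su = trans (delete-other S u≢w) Su

    c∉colors-of-w : ∀ {u} → adj G w u ≡ true → C u ≡ true → c ≢ φ u
    c∉colors-of-w wu Cu refl =
      false≢true (trans (sym (∨-conicalˡ _ _ allowed)) (colorsOf-∋ _ φ (cong₂ _∧_ wu Cu)))

    c∉colors-near : ∀ {v} → adj G w v ≡ true → unsaturated r G C φ v ≡ true →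
                    colorsOf (nbrsIn G C v) φ c ≡ false
    c∉colors-near {v} wv unsat =
      trans (cong (_∧ colorsOf _ φ c) (sym (cong₂ _∧_ wv unsat)))
            (anyFin-false _ v (∨-conicalʳ _ _ allowed))

    proper′ : ∀ u v → S u ≡ true → S v ≡ true → adj G u v ≡ true → φ′ u ≢ φ′ v
    proper′ u v Su Sv uv with u ≟ w | v ≟ w
    ... | yes refl | yes refl = λ _ → false≢true (trans (sym (irrefl G w)) uv)
    ... | yes refl | no  v≢w  = λ eq →
      c∉colors-of-w uv (S⇒C v≢w Sv) (trans (sym φ′-self) (trans eq (φ′-other v≢w)))
    ... | no  u≢w  | yes refl = λ eq →
      c∉colors-of-w (trans (Graph.sym G w u) uv) (S⇒C u≢w Su) (trans (sym φ′-self) (trans (sym eq) (φ′-other u≢w)))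
    ... | no  u≢w  | no  v≢w  = λ eq →
      proper-on hued u v (S⇒C u≢w Su) (S⇒C v≢w Sv) uv (trans (sym (φ′-other u≢w)) (trans eq (φ′-other v≢w)))

    old⊆new : ∀ v c′ → colorsOf (nbrsIn G C v) φ c′ ≡ true → colorsOf (nbrsIn G S v) φ′ c′ ≡ true
    old⊆new v = colorsOf-mono _ _ λ u e →
      cong₂ _∧_ (∧-conicalˡ _ _ e) (delete-⊆ S w u (∧-conicalʳ _ _ e)) , φ′-other (C-≢ (∧-conicalʳ _ _ e))

    colors-grow : ∀ v → nbrColorsIn G C φ v ≤ nbrColorsIn G S φ′ v
    colors-grow v = countTrue-mono (old⊆new v)

    colors-grow-< : ∀ {v} → adj G v w ≡ true → unsaturated r G C φ v ≡ true →
                    nbrColorsIn G C φ v < nbrColorsIn G S φ′ v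
    colors-grow-< {v} vw unsat =
      countTrue-mono-< c (old⊆new v) (c∉colors-near (trans (Graph.sym G w v) vw) unsat)
        (subst (λ c′ → colorsOf _ φ′ c′ ≡ true) φ′-self (colorsOf-∋ _ φ′ (cong₂ _∧_ vw Sw)))

    hued′ : ∀ v → r ⊓ degIn G S v ≤ nbrColorsIn G S φ′ v
    hued′ v with adj G v w in vw
    ... | false = ≤-trans (⊓-monoʳ-≤ r (degIn-delete-nonadj G S vw)) (≤-trans (hued-on hued v) (colors-grow v))
    ... | true with nbrColorsIn G C φ v <? r
    ...   | no  saturated = ≤-trans (m⊓n≤m r _) (≤-trans (≮⇒≥ saturated) (colors-grow v))
    ...   | yes unsat     = begin
      r ⊓ degIn G S v            ≤⟨ m⊓n≤n r _ ⟩
      degIn G S v                ≤⟨ degIn-delete G S w v ⟩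
      suc (degIn G C v)          ≤⟨ s≤s (m⊓n≤o<m⇒n≤o (hued-on hued v) unsat) ⟩
      suc (nbrColorsIn G C φ v)  ≤⟨ colors-grow-< vw (isYes-true (_ <? r) unsat) ⟩
      nbrColorsIn G S φ′ v       ∎
      where open ≤-Reasoning

  extend : IsRHuedOn r G S (updateAt φ w (λ _ → c))
  extend = record { proper-on = proper′ ; hued-on = hued′ }

module ForbiddenCount {n k r : ℕ} {G : Graph n} {S : Fin n → Bool} {w : Fin n} {φ : Fin n → Fin k}
                      (minimal : ∀ v → S v ≡ true → degIn G S w ≤ degIn G S v)
                      (hued : IsRHuedOn r G (delete S w) φ) where

  private
    C : Fin n → Bool
    C = delete S w

    colored : ℕ
    colored = degIn G C w

    unsaturated-nbrs : ℕ
    unsaturated-nbrs = degIn G (unsaturated r G C φ) w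

    forbidden-count : countTrue (forbidden r G C φ w) ≤ colored + unsaturated-nbrs * (r ∸ 1)
    forbidden-count =
      ≤-trans (countTrue-∨≤ (colorsOf (nbrsIn G C w) φ) (λ c → anyFin λ v → unsat-nbr v ∧ colors-near v c))
              (+-mono-≤ (countTrue-colorsOf≤ _ φ) (countTrue-anyFin≤ unsat-nbr colors-near (r ∸ 1) few-colors))
      where
      unsat-nbr : Fin n → Bool
      unsat-nbr = nbrsIn G (unsaturated r G C φ) w
      colors-near : Fin n → Fin k → Bool
      colors-near v = colorsOf (nbrsIn G C v) φ
      few-colors : ∀ v → unsat-nbr v ≡ true → countTrue (colors-near v) ≤ r ∸ 1
      few-colors v e = <⇒≤pred (isYes-sound (_ <? r) (∧-conicalʳ _ _ e))

    saturated-nbrs : r < colored → ∀ {v} → adj G w v ≡ true → C v ≡ true → unsaturated r G C φ v ≡ false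
    saturated-nbrs r<a {v} wv Cv = isYes-false (_ <? r) (≤⇒≯ r≤colors)
      where
      r≤deg : r ≤ degIn G C v
      r≤deg = ≤-pred (begin
        suc r              ≤⟨ r<a ⟩
        colored            ≤⟨ degIn-mono G (delete-⊆ S w) w ⟩
        degIn G S w        ≤⟨ minimal v (delete-⊆ S w v Cv) ⟩
        degIn G S v        ≤⟨ degIn-delete G S w v ⟩
        suc (degIn G C v)  ∎)
        where open ≤-Reasoning
      r≤colors : r ≤ nbrColorsIn G C φ v
      r≤colors = ≤-trans (≤-reflexive (sym (m≤n⇒m⊓n≡m r≤deg))) (hued-on hued v)

    few-unsaturated : unsaturated-nbrs ≤ maxDegree G
    few-unsaturated = ≤-trans (degIn≤deg G _ w) (maxFin-≥ (deg G) w)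

    few-colored-or-unsaturated : r < colored → colored + unsaturated-nbrs ≤ maxDegree G
    few-colored-or-unsaturated r<a =
      ≤-trans (≤-reflexive (countTrue-disjoint-∨ (nbrsIn G C w) (nbrsIn G (unsaturated r G C φ) w) disjoint))
              (≤-trans (countTrue-mono nbrs) (maxFin-≥ (deg G) w))
      where
      disjoint : ∀ v → adj G w v ∧ C v ≡ true → adj G w v ∧ unsaturated r G C φ v ≡ true → ⊥
      disjoint v e₁ e₂ = false≢true
        (trans (sym (saturated-nbrs r<a (∧-conicalˡ _ _ e₁) (∧-conicalʳ _ _ e₁))) (∧-conicalʳ _ _ e₂))
      nbrs : ∀ v → (adj G w v ∧ C v) ∨ (adj G w v ∧ unsaturated r G C φ v) ≡ true → adj G w v ≡ true
      nbrs v e = ∧-conicalˡ _ _ (trans (∧-distribˡ-∨ (adj G w v) _ _) e)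

  forbidden-count< : 2 ≤ r → countTrue (forbidden r G C φ w) < (r ∸ 1) * (maxDegree G + 1) + 2
  forbidden-count< 2≤r = ≤-<-trans forbidden-count
    (color-budget r colored unsaturated-nbrs (maxDegree G) 2≤r cases)
    where
    cases : (colored ≤ r × unsaturated-nbrs ≤ maxDegree G) ⊎ (colored + unsaturated-nbrs ≤ maxDegree G)
    cases with colored ≤? r
    ... | yes a≤r = inj₁ (a≤r , few-unsaturated)
    ... | no  a≰r = inj₂ (few-colored-or-unsaturated (≰⇒> a≰r))

empty⊎argmin : (S : Fin n → Bool) (f : Fin n → ℕ) →
               (∀ u → S u ≡ false) ⊎ ∃ λ w → S w ≡ true × (∀ v → S v ≡ true → f w ≤ f v)
empty⊎argmin {zero}  S f = inj₁ λ ()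
empty⊎argmin {suc n} S f with S zero in S0 | empty⊎argmin (S ∘ suc) (f ∘ suc)
... | false | inj₁ empty            = inj₁ λ { zero → S0 ; (suc u) → empty u }
... | false | inj₂ (w , Sw , min)   = inj₂ (suc w , Sw , λ { zero S0′ → ⊥-elim (false≢true (trans (sym S0) S0′))
                                                         ; (suc v) Sv → min v Sv })
... | true  | inj₁ empty            = inj₂ (zero , S0 , λ { zero _ → ≤-refl
                                                      ; (suc v) Sv → ⊥-elim (false≢true (trans (sym (empty v)) Sv)) })
... | true  | inj₂ (w , Sw , min) with f zero ≤? f (suc w)
...   | yes f0≤fw = inj₂ (zero , S0 , λ { zero _ → ≤-refl ; (suc v) Sv → ≤-trans f0≤fw (min v Sv) })
...   | no  f0≰fw = inj₂ (suc w , Sw , λ { zero _ → <⇒≤ (≰⇒> f0≰fw) ; (suc v) Sv → min v Sv })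

isRHuedOn-exists : (G : Graph n) (r : ℕ) → 2 ≤ r → (s : ℕ) (S : Fin n → Bool) → countTrue S ≤ s →
                   Σ (Fin n → Fin ((r ∸ 1) * (maxDegree G + 1) + 2)) (IsRHuedOn r G S)
isRHuedOn-exists G r 2≤r s S |S|≤s with empty⊎argmin S (degIn G S)
... | inj₁ empty = (λ _ → _ ↑ʳ zero) , isRHuedOn-empty _ empty
isRHuedOn-exists G r 2≤r zero S |S|≤0 | inj₂ (w , Sw , _) =
  ⊥-elim (n≮0 (<-≤-trans (countTrue-delete S Sw) |S|≤0))
isRHuedOn-exists G r 2≤r (suc s) S |S|≤1+s | inj₂ (w , Sw , minimal)
  with isRHuedOn-exists G r 2≤r s (delete S w) (≤-pred (<-≤-trans (countTrue-delete S Sw) |S|≤1+s))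
... | φ , hued with countTrue<⇒false _ (ForbiddenCount.forbidden-count< minimal hued 2≤r)
...   | c , allowed = updateAt φ w (λ _ → c) , Extension.extend Sw hued allowed

theorem4 : ∀ {n} (G : Graph n) (r : ℕ) → 2 ≤ r →
    χ-≤ r G ((r ∸ 1) * (maxDegree G + 1) + 2)
theorem4 G r 2≤r with isRHuedOn-exists G r 2≤r _ (λ _ → true) ≤-refl
... | φ , hued = φ , isRHuedOn-all⇒isRHued hued
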